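{- Let $m\geqslant 4$ be an integer. For all integers $w,z\geqslant 2m$ with $w+z\leqslant 2m^2$, we have $b_m(w)\,b_m(z)>b_m(w+z)$.
   Context: For an integer $m\geqslant2$, the $m$-ary partition function $b_m(n)$ is the number of partitions of $n$ all of whose parts belong to $\{1,m,m^2,m^3,\ldots\}$. -}

module Defs where

open import Data.Nat using (ℕ; zero; suc; _+_; _*_; _∸_; _^_; _≤_; _≤ᵇ_)
open import Data.Bool using (if_then_else_)
open import Data.List using (List; []; _∷_; filterᵇ; map; upTo)

-- Number of partitions of n into parts taken from the list ps
-- (ps is assumed to list distinct positive part sizes).
-- A partition is determined by the multiplicity of each allowed part;
-- we count by choosing the multiplicity j of the first part p
-- (so that j * p ≤ n) and recursing on the rest.
countParts : List ℕ → ℕ → ℕ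
countParts [] zero = 1
countParts [] (suc _) = 0
countParts (p ∷ ps) n = sumMult (suc n)
  where
  sumMult : ℕ → ℕ
  sumMult zero = 0
  sumMult (suc j) = (if j * p ≤ᵇ n then countParts ps (n ∸ j * p) else 0) + sumMult j

-- The allowed parts for b_m(n): the powers m^0, m^1, ..., m^(n-1) that are ≤ n.
-- (Any power m^k ≤ n, with m ≥ 2, has k < n; for m ≥ 2 these are distinct.)
powerParts : ℕ → ℕ → List ℕ
powerParts m n = filterᵇ (λ q → q ≤ᵇ n) (map (m ^_) (upTo n))

b : ℕ → ℕ → ℕ
b m n = countParts (powerParts m n) n

{-# OPTIONS --safe #-}
-- Below m³ only the parts 1, m and m² occur, and sorting the partitions by the total j * m
-- of the parts m and m² gives b m n = Σ_{j ≤ n/m} (1 + j/m).  So b m w ≥ a + 1 for a = w/m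
-- and b m z ≥ c + 1 for c = z/m.  As (w + z)/m ≤ a + c + 1 ≤ 2m + 1, every summand for w + z
-- is at most 3 and the first six add up to at most 8, whence b m (w + z) ≤ 3(a + c + 1) - 7,
-- which falls short of (a + 1)(c + 1) by (a - 2)(c - 2) + 1.
module Submission where

open import Data.Bool using (T; true; false; if_then_else_)
open import Data.List using (List; []; _∷_; _++_; map; filterᵇ; upTo; applyUpTo)
open import Data.List.Properties
  using (filter-++; filter-none; filter-accept; filter-reject; ++-identityʳ)
open import Data.List.Relation.Unary.All using (All; []; _∷_)
open import Data.List.Relation.Unary.All.Properties using (map⁺; applyUpTo⁺₁)
open import Data.Nat
open import Data.Nat.DivMod
open import Data.Nat.Divisibility
open import Data.Nat.Properties
open import Data.Nat.Solver using (module +-*-Solver)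
open import Function using (_∘_)
open import Relation.Binary.PropositionalEquality
open import Relation.Nullary using (¬_; yes; no; contradiction; T?)

open import Defs

∑< : ℕ → (ℕ → ℕ) → ℕ
∑< zero    f = 0
∑< (suc n) f = f n + ∑< n f

syntax ∑< n (λ i → e) = ∑[ i < n ] e

module _ {f g : ℕ → ℕ} where

  ∑-cong : ∀ n → (∀ i → i < n → f i ≡ g i) → ∑< n f ≡ ∑< n g
  ∑-cong zero    _  = refl
  ∑-cong (suc n) eq = cong₂ _+_ (eq n ≤-refl) (∑-cong n (λ i i<n → eq i (m<n⇒m<1+n i<n)))

  ∑-mono-≤ : ∀ n → (∀ i → i < n → f i ≤ g i) → ∑< n f ≤ ∑< n g
  ∑-mono-≤ zero    _  = z≤n
  ∑-mono-≤ (suc n) le = +-mono-≤ (le n ≤-refl) (∑-mono-≤ n (λ i i<n → le i (m<n⇒m<1+n i<n)))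

∑-const : ∀ {f : ℕ → ℕ} {c} n → (∀ i → i < n → f i ≡ c) → ∑< n f ≡ n * c
∑-const zero    _  = refl
∑-const (suc n) eq = cong₂ _+_ (eq n ≤-refl) (∑-const n (λ i i<n → eq i (m<n⇒m<1+n i<n)))

∑-zero : ∀ {f : ℕ → ℕ} n → (∀ i → i < n → f i ≡ 0) → ∑< n f ≡ 0
∑-zero n eq = trans (∑-const n eq) (*-zeroʳ n)

∑-+ : ∀ (f : ℕ → ℕ) m n → ∑[ i < m + n ] f i ≡ ∑[ i < m ] f i + ∑[ i < n ] f (m + i)
∑-+ f m zero    = trans (cong (λ k → ∑< k f) (+-identityʳ m)) (sym (+-identityʳ _))
∑-+ f m (suc n) = begin
  ∑[ i < m + suc n ] f i                          ≡⟨ cong (λ k → ∑< k f) (+-suc m n) ⟩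
  f (m + n) + ∑[ i < m + n ] f i                  ≡⟨ cong (f (m + n) +_) (∑-+ f m n) ⟩
  f (m + n) + (∑< m f + ∑[ i < n ] f (m + i))     ≡⟨ +-assoc (f (m + n)) _ _ ⟨
  f (m + n) + ∑< m f + ∑[ i < n ] f (m + i)       ≡⟨ cong (_+ ∑[ i < n ] f (m + i)) (+-comm (f (m + n)) _) ⟩
  ∑< m f + f (m + n) + ∑[ i < n ] f (m + i)       ≡⟨ +-assoc (∑< m f) _ _ ⟩
  ∑< m f + ∑[ i < suc n ] f (m + i)               ∎
  where open ≡-Reasoning

∑-suc : ∀ (f : ℕ → ℕ) n → ∑[ i < suc n ] f i ≡ f 0 + ∑[ i < n ] f (suc i)
∑-suc f n = trans (∑-+ f 1 n) (cong (_+ ∑[ i < n ] f (suc i)) (+-identityʳ (f 0)))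

∑-prefix-≤ : ∀ (f : ℕ → ℕ) {m n} → m ≤ n → ∑< m f ≤ ∑< n f
∑-prefix-≤ f {m} {n} m≤n = begin
  ∑< m f                                ≤⟨ m≤m+n (∑< m f) _ ⟩
  ∑< m f + ∑[ i < n ∸ m ] f (m + i)     ≡⟨ ∑-+ f m (n ∸ m) ⟨
  ∑< (m + (n ∸ m)) f                    ≡⟨ cong (λ k → ∑< k f) (m+[n∸m]≡n m≤n) ⟩
  ∑< n f                                ∎
  where open ≤-Reasoning

∑-zeros-from : ∀ (f : ℕ → ℕ) {m n} → m ≤ n → (∀ i → m ≤ i → f i ≡ 0) → ∑< n f ≡ ∑< m f
∑-zeros-from f {m} {n} m≤n zeros = begin
  ∑< n f                                ≡⟨ cong (λ k → ∑< k f) (m+[n∸m]≡n m≤n) ⟨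
  ∑< (m + (n ∸ m)) f                    ≡⟨ ∑-+ f m (n ∸ m) ⟩
  ∑< m f + ∑[ i < n ∸ m ] f (m + i)     ≡⟨ cong (∑< m f +_) (∑-zero (n ∸ m) (λ i _ → zeros (m + i) (m≤m+n m i))) ⟩
  ∑< m f + 0                            ≡⟨ +-identityʳ _ ⟩
  ∑< m f                                ∎
  where open ≡-Reasoning

n≡n/m*m+n%m : ∀ n m .{{_ : NonZero m}} → n ≡ n / m * m + n % m
n≡n/m*m+n%m n m = trans (m≡m%n+[m/n]*n n m) (+-comm (n % m) (n / m * m))

∑-multiples : ∀ {m} (f : ℕ → ℕ) .{{_ : NonZero m}} → (∀ i → m ∤ i → f i ≡ 0) →
              ∀ n → ∑[ i < suc n ] f i ≡ ∑[ j < suc (n / m) ] f (j * m)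
∑-multiples {m} f off-multiples n = begin
  ∑[ i < suc n ] f i                    ≡⟨ cong (λ k → ∑< (suc k) f) (n≡n/m*m+n%m n m) ⟩
  ∑[ i < suc (n / m * m + n % m) ] f i  ≡⟨ blocks (n / m) (n % m) (m%n<n n m) ⟩
  ∑[ j < suc (n / m) ] f (j * m)        ∎
  where
  open ≡-Reasoning
  blocks : ∀ q r → r < m → ∑[ i < suc (q * m + r) ] f i ≡ ∑[ j < suc q ] f (j * m)
  blocks zero    zero    _   = refl
  blocks (suc q) zero    _   =
    cong₂ _+_ (cong f (+-identityʳ _))
              (trans (cong (λ k → ∑< k f) end≡) (blocks q (pred m) (≤-reflexive (suc-pred m))))
    where
    end≡ : suc q * m + 0 ≡ suc (q * m + pred m)
    end≡ = begin
      suc q * m + 0          ≡⟨ +-identityʳ _ ⟩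
      m + q * m              ≡⟨ +-comm m (q * m) ⟩
      q * m + m              ≡⟨ cong (q * m +_) (suc-pred m) ⟨
      q * m + suc (pred m)   ≡⟨ +-suc (q * m) (pred m) ⟩
      suc (q * m + pred m)   ∎
  blocks q       (suc r) r<m = begin
    ∑[ i < suc (q * m + suc r) ] f i                     ≡⟨ cong (λ k → ∑< (suc k) f) (+-suc (q * m) r) ⟩
    f (suc (q * m + r)) + ∑[ i < suc (q * m + r) ] f i   ≡⟨ cong (_+ ∑[ i < suc (q * m + r) ] f i) f[qm+1+r]≡0 ⟩
    ∑[ i < suc (q * m + r) ] f i                         ≡⟨ blocks q r (<-trans (n<1+n r) r<m) ⟩
    ∑[ j < suc q ] f (j * m)                             ∎
    where
    m∤qm+1+r : m ∤ q * m + suc r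
    m∤qm+1+r m∣ = <⇒≱ r<m (∣⇒≤ (∣m+n∣m⇒∣n m∣ (n∣m*n q)))
    f[qm+1+r]≡0 : f (suc (q * m + r)) ≡ 0
    f[qm+1+r]≡0 = trans (cong f (sym (+-suc (q * m) r))) (off-multiples _ m∤qm+1+r)

n<suc[n/m]*m : ∀ n m .{{_ : NonZero m}} → n < suc (n / m) * m
n<suc[n/m]*m n m = begin-strict
  n                   ≡⟨ m≡m%n+[m/n]*n n m ⟩
  n % m + n / m * m   <⟨ +-monoˡ-< (n / m * m) (m%n<n n m) ⟩
  suc (n / m) * m     ∎
  where open ≤-Reasoning

[m+n]/d≤suc[m/d+n/d] : ∀ m n d .{{_ : NonZero d}} → (m + n) / d ≤ suc (m / d + n / d)
[m+n]/d≤suc[m/d+n/d] m n d = m<1+n⇒m≤n (m<n*o⇒m/o<n (begin-strict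
  m + n                               <⟨ +-mono-< (n<suc[n/m]*m m d) (n<suc[n/m]*m n d) ⟩
  suc (m / d) * d + suc (n / d) * d   ≡⟨ *-distribʳ-+ d (suc (m / d)) (suc (n / d)) ⟨
  (suc (m / d) + suc (n / d)) * d     ≡⟨ cong (λ k → suc k * d) (+-suc (m / d) (n / d)) ⟩
  suc (suc (m / d + n / d)) * d       ∎))
  where open ≤-Reasoning

m*n≤o⇒m≤o/n : ∀ m {n o} .{{_ : NonZero n}} → m * n ≤ o → m ≤ o / n
m*n≤o⇒m≤o/n m {n} mn≤o = subst (_≤ _ / n) (m*n/n≡m m n) (/-monoˡ-≤ n mn≤o)

m+n≤o*d⇒m/d+n/d≤o : ∀ m n o {d} .{{_ : NonZero d}} → m + n ≤ o * d → m / d + n / d ≤ o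
m+n≤o*d⇒m/d+n/d≤o m n o {d} m+n≤od = *-cancelʳ-≤ (m / d + n / d) o d (begin
  (m / d + n / d) * d       ≡⟨ *-distribʳ-+ d (m / d) (n / d) ⟩
  m / d * d + n / d * d     ≤⟨ +-mono-≤ (m/n*n≤m m d) (m/n*n≤m n d) ⟩
  m + n                     ≤⟨ m+n≤od ⟩
  o * d                     ∎)
  where open ≤-Reasoning

2*[m*m]<m^3 : ∀ m → 3 ≤ m → 2 * (m * m) < m ^ 3
2*[m*m]<m^3 m@(suc _) 3≤m = begin-strict
  2 * (m * m)    <⟨ *-monoˡ-< (m * m) 3≤m ⟩
  m * (m * m)    ≡⟨ cong (λ k → m * (m * k)) (*-identityʳ m) ⟨
  m ^ 3          ∎
  where open ≤-Reasoning

withMult : ℕ → List ℕ → ℕ → ℕ → ℕ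
withMult p ps n j = if j * p ≤ᵇ n then countParts ps (n ∸ j * p) else 0

-- `countParts` sums over the multiplicity of its first part with a `where`-bound helper that
-- is out of scope outside Defs.  Abstracting the target `suc (n + 0)` and the fuel `n + 0` in
-- the unfolded goal leaves that helper applied to two fresh variables, so unification finds
-- it as `G`.
countParts-∷ : ∀ p ps n → countParts (p ∷ ps) n ≡ ∑[ j < suc n ] withMult p ps n j
countParts-∷ p ps zero    = refl
countParts-∷ p ps (suc n) =
  subst (λ k → countParts (p ∷ ps) (suc k) ≡ ∑[ j < suc (suc k) ] withMult p ps (suc k) j)
        (+-identityʳ n) unfolded
  where
  fuel-∑ : (G : ℕ → ℕ → ℕ) → (∀ k → G k 0 ≡ 0) → (∀ k j → G k (suc j) ≡ withMult p ps k j + G k j) →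
           ∀ k y → G k y ≡ ∑[ j < y ] withMult p ps k j
  fuel-∑ G G0 Gsuc k zero    = G0 k
  fuel-∑ G G0 Gsuc k (suc y) = trans (Gsuc k y) (cong (withMult p ps k y +_) (fuel-∑ G G0 Gsuc k y))

  unfolded : countParts (p ∷ ps) (suc (n + 0)) ≡ ∑[ j < suc (suc (n + 0)) ] withMult p ps (suc (n + 0)) j
  unfolded with n + 0 | suc (n + 0) | fuel-∑ _ (λ _ → refl) (λ _ _ → refl)
  ... | y | k | helper≡∑ = cong (withMult p ps k (suc y) +_) (cong (withMult p ps k y +_) (helper≡∑ k y))

withMult-≤ : ∀ p ps {n} j → j * p ≤ n → withMult p ps n j ≡ countParts ps (n ∸ j * p)
withMult-≤ p ps {n} j jp≤n with j * p ≤ᵇ n | ≤⇒≤ᵇ jp≤n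
... | true | _ = refl

withMult-> : ∀ p ps {n} j → n < j * p → withMult p ps n j ≡ 0
withMult-> p ps {n} j n<jp with j * p ≤ᵇ n | ≤ᵇ⇒≤ (j * p) n
... | false | _    = refl
... | true  | jp≤n = contradiction (jp≤n _) (<⇒≱ n<jp)

countParts-∷-cong : ∀ p {ps qs} n → (∀ k → k ≤ n → countParts ps k ≡ countParts qs k) →
                    countParts (p ∷ ps) n ≡ countParts (p ∷ qs) n
countParts-∷-cong p {ps} {qs} n eq = begin
  countParts (p ∷ ps) n              ≡⟨ countParts-∷ p ps n ⟩
  ∑[ j < suc n ] withMult p ps n j   ≡⟨ ∑-cong (suc n) (λ j _ → withMult-cong j) ⟩
  ∑[ j < suc n ] withMult p qs n j   ≡⟨ countParts-∷ p qs n ⟨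
  countParts (p ∷ qs) n              ∎
  where
  open ≡-Reasoning
  withMult-cong : ∀ j → withMult p ps n j ≡ withMult p qs n j
  withMult-cong j with j * p ≤ᵇ n
  ... | true  = eq (n ∸ j * p) (m∸n≤m n (j * p))
  ... | false = refl

countParts-∷-< : ∀ {p} ps {n} → n < p → countParts (p ∷ ps) n ≡ countParts ps n
countParts-∷-< {p} ps {n} n<p = begin
  countParts (p ∷ ps) n                                  ≡⟨ countParts-∷ p ps n ⟩
  ∑[ j < suc n ] withMult p ps n j                       ≡⟨ ∑-suc (withMult p ps n) n ⟩
  countParts ps n + ∑[ j < n ] withMult p ps n (suc j)   ≡⟨ cong (countParts ps n +_) (∑-zero n too-many) ⟩
  countParts ps n + 0                                    ≡⟨ +-identityʳ _ ⟩
  countParts ps n                                        ∎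
  where
  open ≡-Reasoning
  too-many : ∀ j → j < n → withMult p ps n (suc j) ≡ 0
  too-many j _ = withMult-> p ps (suc j) (<-≤-trans n<p (m≤m+n p (j * p)))

countParts-∷-≥ : ∀ {p} ps {n} .{{_ : NonZero p}} → p ≤ n →
                 countParts (p ∷ ps) n ≡ countParts ps n + countParts (p ∷ ps) (n ∸ p)
countParts-∷-≥ {p} ps {n} p≤n = begin
  countParts (p ∷ ps) n                                  ≡⟨ countParts-∷ p ps n ⟩
  ∑[ j < suc n ] withMult p ps n j                       ≡⟨ ∑-suc (withMult p ps n) n ⟩
  countParts ps n + ∑[ j < n ] withMult p ps n (suc j)   ≡⟨ cong (countParts ps n +_) one-less ⟩
  countParts ps n + countParts (p ∷ ps) (n ∸ p)          ∎
  where
  open ≡-Reasoning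
  ≤-shift : ∀ {x} → x ≤ n ∸ p → p + x ≤ n
  ≤-shift x≤n∸p = subst (p + _ ≤_) (m+[n∸m]≡n p≤n) (+-monoʳ-≤ p x≤n∸p)
  <-shift : ∀ {x} → n ∸ p < x → n < p + x
  <-shift n∸p<x = subst (_< p + _) (m+[n∸m]≡n p≤n) (+-monoʳ-< p n∸p<x)
  shift : ∀ j → withMult p ps n (suc j) ≡ withMult p ps (n ∸ p) j
  shift j with j * p ≤? n ∸ p
  ... | yes jp≤n∸p = begin
    withMult p ps n (suc j)           ≡⟨ withMult-≤ p ps (suc j) (≤-shift jp≤n∸p) ⟩
    countParts ps (n ∸ (p + j * p))   ≡⟨ cong (countParts ps) (∸-+-assoc n p (j * p)) ⟨
    countParts ps (n ∸ p ∸ j * p)     ≡⟨ withMult-≤ p ps j jp≤n∸p ⟨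
    withMult p ps (n ∸ p) j           ∎
  ... | no  jp≰n∸p = begin
    withMult p ps n (suc j)           ≡⟨ withMult-> p ps (suc j) (<-shift (≰⇒> jp≰n∸p)) ⟩
    0                                 ≡⟨ withMult-> p ps j (≰⇒> jp≰n∸p) ⟨
    withMult p ps (n ∸ p) j           ∎
  n∸p<n : n ∸ p < n
  n∸p<n = ∸-monoʳ-< (>-nonZero⁻¹ p) p≤n
  too-many : ∀ j → n ∸ p < j → withMult p ps (n ∸ p) j ≡ 0
  too-many j n∸p<j = withMult-> p ps j (<-≤-trans n∸p<j (m≤m*n j p))
  one-less : ∑[ j < n ] withMult p ps n (suc j) ≡ countParts (p ∷ ps) (n ∸ p)
  one-less = begin
    ∑[ j < n ] withMult p ps n (suc j)             ≡⟨ ∑-cong n (λ j _ → shift j) ⟩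
    ∑[ j < n ] withMult p ps (n ∸ p) j             ≡⟨ ∑-zeros-from _ n∸p<n too-many ⟩
    ∑[ j < suc (n ∸ p) ] withMult p ps (n ∸ p) j   ≡⟨ countParts-∷ p ps (n ∸ p) ⟨
    countParts (p ∷ ps) (n ∸ p)                    ∎

countParts-filter : ∀ n ps {k} → k ≤ n → countParts (filterᵇ (_≤ᵇ n) ps) k ≡ countParts ps k
countParts-filter n []       k≤n = refl
countParts-filter n (p ∷ ps) {k} k≤n with p ≤? n
... | yes p≤n = begin
  countParts (filterᵇ (_≤ᵇ n) (p ∷ ps)) k  ≡⟨ cong (λ qs → countParts qs k) kept ⟩
  countParts (p ∷ filterᵇ (_≤ᵇ n) ps) k    ≡⟨ countParts-∷-cong p k (λ i i≤k → countParts-filter n ps (≤-trans i≤k k≤n)) ⟩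
  countParts (p ∷ ps) k                    ∎
  where
  open ≡-Reasoning
  kept : filterᵇ (_≤ᵇ n) (p ∷ ps) ≡ p ∷ filterᵇ (_≤ᵇ n) ps
  kept = filter-accept (T? ∘ (_≤ᵇ n)) {p} (≤⇒≤ᵇ p≤n)
... | no p≰n = begin
  countParts (filterᵇ (_≤ᵇ n) (p ∷ ps)) k  ≡⟨ cong (λ qs → countParts qs k) dropped ⟩
  countParts (filterᵇ (_≤ᵇ n) ps) k        ≡⟨ countParts-filter n ps k≤n ⟩
  countParts ps k                          ≡⟨ countParts-∷-< ps (≤-<-trans k≤n (≰⇒> p≰n)) ⟨
  countParts (p ∷ ps) k                    ∎
  where
  open ≡-Reasoning
  dropped : filterᵇ (_≤ᵇ n) (p ∷ ps) ≡ filterᵇ (_≤ᵇ n) ps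
  dropped = filter-reject (T? ∘ (_≤ᵇ n)) {p} (p≰n ∘ ≤ᵇ⇒≤ p n)

countParts-∷-multiples : ∀ {p} ps j {t} .{{_ : NonZero p}} → t < p →
                         countParts (p ∷ ps) (j * p + t) ≡ ∑[ i < suc j ] countParts ps (i * p + t)
countParts-∷-multiples {p} ps zero    {t} t<p = trans (countParts-∷-< ps t<p) (sym (+-identityʳ _))
countParts-∷-multiples {p} ps (suc j) {t} t<p = begin
  countParts (p ∷ ps) (suc j * p + t)                          ≡⟨ countParts-∷-≥ ps p≤n ⟩
  countParts ps n + countParts (p ∷ ps) (p + j * p + t ∸ p)    ≡⟨ cong ((countParts ps n +_) ∘ countParts (p ∷ ps)) n∸p≡jp+t ⟩
  countParts ps n + countParts (p ∷ ps) (j * p + t)            ≡⟨ cong (countParts ps n +_) (countParts-∷-multiples ps j t<p) ⟩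
  countParts ps n + ∑[ i < suc j ] countParts ps (i * p + t)   ∎
  where
  open ≡-Reasoning
  n = suc j * p + t
  p≤n : p ≤ n
  p≤n = ≤-trans (m≤m+n p (j * p)) (m≤m+n (suc j * p) t)
  n∸p≡jp+t : p + j * p + t ∸ p ≡ j * p + t
  n∸p≡jp+t = trans (cong (_∸ p) (+-assoc p (j * p) t)) (m+n∸m≡n p (j * p + t))

countParts-1∷ : ∀ ps n → countParts (1 ∷ ps) n ≡ ∑[ i < suc n ] countParts ps i
countParts-1∷ ps n = begin
  countParts (1 ∷ ps) n                      ≡⟨ cong (countParts (1 ∷ ps)) (i*1+0≡i n) ⟨
  countParts (1 ∷ ps) (n * 1 + 0)            ≡⟨ countParts-∷-multiples ps n z<s ⟩
  ∑[ i < suc n ] countParts ps (i * 1 + 0)   ≡⟨ ∑-cong (suc n) (λ i _ → cong (countParts ps) (i*1+0≡i i)) ⟩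
  ∑[ i < suc n ] countParts ps i             ∎
  where
  open ≡-Reasoning
  i*1+0≡i : ∀ i → i * 1 + 0 ≡ i
  i*1+0≡i i = trans (+-identityʳ (i * 1)) (*-identityʳ i)

countParts-[]-nonZero : ∀ n .{{_ : NonZero n}} → countParts [] n ≡ 0
countParts-[]-nonZero (suc n) = refl

countParts-[]-* : ∀ k m .{{_ : NonZero m}} → countParts [] (k * m) ≡ countParts [] k
countParts-[]-* zero    m = refl
countParts-[]-* (suc k) m = countParts-[]-nonZero (suc k * m) {{m*n≢0 (suc k) m}}

countParts-singleton : ∀ {p} n .{{_ : NonZero p}} → countParts (p ∷ []) n ≡ countParts [] (n % p)
countParts-singleton {p} n = begin
  countParts (p ∷ []) n                                        ≡⟨ cong (countParts (p ∷ [])) (n≡n/m*m+n%m n p) ⟩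
  countParts (p ∷ []) (q * p + r)                              ≡⟨ countParts-∷-multiples [] q (m%n<n n p) ⟩
  ∑[ i < suc q ] countParts [] (i * p + r)                     ≡⟨ ∑-suc (λ i → countParts [] (i * p + r)) q ⟩
  countParts [] r + ∑[ i < q ] countParts [] (suc i * p + r)   ≡⟨ cong (countParts [] r +_) (∑-zero q positive) ⟩
  countParts [] r + 0                                          ≡⟨ +-identityʳ _ ⟩
  countParts [] r                                              ∎
  where
  open ≡-Reasoning
  q = n / p
  r = n % p
  positive : ∀ i → i < q → countParts [] (suc i * p + r) ≡ 0
  positive i _ = countParts-[]-nonZero (suc i * p + r)
    {{>-nonZero (≤-trans (>-nonZero⁻¹ p) (≤-trans (m≤m+n p (i * p)) (m≤m+n (suc i * p) r)))}}

countParts-singleton-* : ∀ p m i .{{_ : NonZero p}} .{{_ : NonZero m}} →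
                         countParts (p * m ∷ []) (i * m) ≡ countParts (p ∷ []) i
countParts-singleton-* p m i = begin
  countParts (p * m ∷ []) (i * m)     ≡⟨ countParts-singleton (i * m) ⟩
  countParts [] (i * m % (p * m))     ≡⟨ cong (countParts []) (m%n*o≡m*o%[n*o] i p m) ⟨
  countParts [] (i % p * m)           ≡⟨ countParts-[]-* (i % p) m ⟩
  countParts [] (i % p)               ≡⟨ countParts-singleton i ⟨
  countParts (p ∷ []) i               ∎
  where
  open ≡-Reasoning
  instance
    pm≢0 : NonZero (p * m)
    pm≢0 = m*n≢0 p m

countParts-∤ : ∀ {d} ps n → All (d ∣_) ps → d ∤ n → countParts ps n ≡ 0
countParts-∤ []       zero    _ d∤0 = contradiction (_ ∣0) d∤0
countParts-∤ []       (suc n) _ _   = refl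
countParts-∤ {d} (p ∷ ps) n (d∣p ∷ d∣ps) d∤n =
  trans (countParts-∷ p ps n) (∑-zero (suc n) (λ j _ → withMult≡0 j))
  where
  withMult≡0 : ∀ j → withMult p ps n j ≡ 0
  withMult≡0 j with j * p ≤? n
  ... | no  jp≰n = withMult-> p ps j (≰⇒> jp≰n)
  ... | yes jp≤n = trans (withMult-≤ p ps j jp≤n) (countParts-∤ ps (n ∸ j * p) d∣ps d∤n∸jp)
    where
    d∤n∸jp : d ∤ n ∸ j * p
    d∤n∸jp d∣n∸jp = d∤n (∣m∸n∣n⇒∣m d jp≤n d∣n∸jp (∣-trans d∣p (n∣m*n j)))

countParts-1∷m : ∀ m .{{_ : NonZero m}} n → countParts (1 ∷ m ∷ []) n ≡ suc (n / m)
countParts-1∷m m n = begin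
  countParts (1 ∷ m ∷ []) n                          ≡⟨ countParts-1∷ (m ∷ []) n ⟩
  ∑[ i < suc n ] countParts (m ∷ []) i               ≡⟨ ∑-multiples _ (λ i → countParts-∤ (m ∷ []) i (∣-refl ∷ [])) n ⟩
  ∑[ j < suc (n / m) ] countParts (m ∷ []) (j * m)   ≡⟨ ∑-const (suc (n / m)) (λ j _ → one j) ⟩
  suc (n / m) * 1                                    ≡⟨ *-identityʳ _ ⟩
  suc (n / m)                                        ∎
  where
  open ≡-Reasoning
  one : ∀ j → countParts (m ∷ []) (j * m) ≡ 1
  one j = trans (countParts-singleton (j * m)) (cong (countParts []) (m*n%n≡0 j m))

countParts-m∷m² : ∀ m .{{_ : NonZero m}} j → countParts (m ∷ m * m ∷ []) (j * m) ≡ suc (j / m)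
countParts-m∷m² m j = begin
  countParts (m ∷ m * m ∷ []) (j * m)                  ≡⟨ cong (countParts (m ∷ m * m ∷ [])) (+-identityʳ (j * m)) ⟨
  countParts (m ∷ m * m ∷ []) (j * m + 0)              ≡⟨ countParts-∷-multiples (m * m ∷ []) j (>-nonZero⁻¹ m) ⟩
  ∑[ i < suc j ] countParts (m * m ∷ []) (i * m + 0)   ≡⟨ ∑-cong (suc j) (λ i _ → scale i) ⟩
  ∑[ i < suc j ] countParts (m ∷ []) i                 ≡⟨ countParts-1∷ (m ∷ []) j ⟨
  countParts (1 ∷ m ∷ []) j                            ≡⟨ countParts-1∷m m j ⟩
  suc (j / m)                                          ∎
  where
  open ≡-Reasoning
  scale : ∀ i → countParts (m * m ∷ []) (i * m + 0) ≡ countParts (m ∷ []) i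
  scale i = trans (cong (countParts (m * m ∷ [])) (+-identityʳ (i * m))) (countParts-singleton-* m m i)

-- Partitions of n into 1, m and m²: the parts m and m² add up to some j * m with j ≤ n / m,
-- and j * m splits into them in suc (j / m) ways.
b₃ : ∀ m .{{_ : NonZero m}} → ℕ → ℕ
b₃ m k = ∑[ j < suc k ] suc (j / m)

countParts-1∷m∷m² : ∀ m .{{_ : NonZero m}} n → countParts (1 ∷ m ∷ m * m ∷ []) n ≡ b₃ m (n / m)
countParts-1∷m∷m² m n = begin
  countParts (1 ∷ m ∷ m * m ∷ []) n                          ≡⟨ countParts-1∷ (m ∷ m * m ∷ []) n ⟩
  ∑[ i < suc n ] countParts (m ∷ m * m ∷ []) i               ≡⟨ ∑-multiples _ off-multiples n ⟩
  ∑[ j < suc (n / m) ] countParts (m ∷ m * m ∷ []) (j * m)   ≡⟨ ∑-cong (suc (n / m)) (λ j _ → countParts-m∷m² m j) ⟩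
  b₃ m (n / m)                                               ∎
  where
  open ≡-Reasoning
  off-multiples : ∀ i → m ∤ i → countParts (m ∷ m * m ∷ []) i ≡ 0
  off-multiples i = countParts-∤ (m ∷ m * m ∷ []) i (∣-refl ∷ m∣m*n m ∷ [])

powerParts-below-cube : ∀ m .{{_ : NonZero m}} n → 3 ≤ n → n < m ^ 3 →
                        powerParts m n ≡ filterᵇ (_≤ᵇ n) (map (m ^_) (upTo 3))
powerParts-below-cube m 0 () _
powerParts-below-cube m 1 (s≤s ()) _
powerParts-below-cube m 2 (s≤s (s≤s ())) _
powerParts-below-cube m n@(suc (suc (suc k))) _ n<m³ = begin
  filterᵇ (_≤ᵇ n) (low ++ high)                      ≡⟨ filter-++ (T? ∘ (_≤ᵇ n)) low high ⟩
  filterᵇ (_≤ᵇ n) low ++ filterᵇ (_≤ᵇ n) high        ≡⟨ cong (filterᵇ (_≤ᵇ n) low ++_) (filter-none (T? ∘ (_≤ᵇ n)) high-too-big) ⟩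
  filterᵇ (_≤ᵇ n) low ++ []                          ≡⟨ ++-identityʳ _ ⟩
  filterᵇ (_≤ᵇ n) low                                ∎
  where
  open ≡-Reasoning
  low  = map (m ^_) (upTo 3)
  high = map (m ^_) (applyUpTo (3 +_) k)
  high-too-big : All (λ q → ¬ T (q ≤ᵇ n)) high
  high-too-big = map⁺ (applyUpTo⁺₁ (3 +_) k (λ {i} _ le →
    <⇒≱ (<-≤-trans n<m³ (^-monoʳ-≤ m (m≤m+n 3 i))) (≤ᵇ⇒≤ _ n le)))

b-below-cube : ∀ m .{{_ : NonZero m}} n → 3 ≤ n → n < m ^ 3 → b m n ≡ b₃ m (n / m)
b-below-cube m n 3≤n n<m³ = begin
  countParts (powerParts m n) n                          ≡⟨ cong (λ ps → countParts ps n) (powerParts-below-cube m n 3≤n n<m³) ⟩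
  countParts (filterᵇ (_≤ᵇ n) (map (m ^_) (upTo 3))) n   ≡⟨ countParts-filter n (map (m ^_) (upTo 3)) ≤-refl ⟩
  countParts (1 ∷ m * 1 ∷ m * (m * 1) ∷ []) n            ≡⟨ cong (λ k → countParts (1 ∷ k ∷ m * k ∷ []) n) (*-identityʳ m) ⟩
  countParts (1 ∷ m ∷ m * m ∷ []) n                      ≡⟨ countParts-1∷m∷m² m n ⟩
  b₃ m (n / m)                                           ∎
  where open ≡-Reasoning

b₃-mono : ∀ m .{{_ : NonZero m}} {k l} → k ≤ l → b₃ m k ≤ b₃ m l
b₃-mono m k≤l = ∑-prefix-≤ (λ j → suc (j / m)) (s≤s k≤l)

suc≤b₃ : ∀ m .{{_ : NonZero m}} k → suc k ≤ b₃ m k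
suc≤b₃ m k = begin
  suc k               ≡⟨ *-identityʳ (suc k) ⟨
  suc k * 1           ≡⟨ ∑-const (suc k) (λ _ _ → refl) ⟨
  ∑[ j < suc k ] 1    ≤⟨ ∑-mono-≤ (suc k) (λ j _ → s≤s z≤n) ⟩
  b₃ m k              ∎
  where open ≤-Reasoning

-- Below 3 * m each summand suc (j / m) is at most 3; the base case compares with m = 4.
b₃+7≤3* : ∀ m .{{_ : NonZero m}} → 4 ≤ m → ∀ {k} → 5 ≤ k → k < 3 * m → b₃ m k + 7 ≤ 3 * k
b₃+7≤3* m 4≤m {k} 5≤k k<3m = subst (λ k → b₃ m k + 7 ≤ 3 * k) 5+[k∸5]≡k
                                   (from-five (k ∸ 5) (subst (_< 3 * m) (sym 5+[k∸5]≡k) k<3m))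
  where
  5+[k∸5]≡k : 5 + (k ∸ 5) ≡ k
  5+[k∸5]≡k = m+[n∸m]≡n 5≤k
  from-five : ∀ d → 5 + d < 3 * m → b₃ m (5 + d) + 7 ≤ 3 * (5 + d)
  from-five zero    _      = +-monoˡ-≤ 7 (∑-mono-≤ 6 (λ j _ → s≤s (/-monoʳ-≤ j 4≤m)))
  from-five (suc d) 6+d<3m = begin
    b₃ m (6 + d) + 7                         ≡⟨ +-assoc (suc ((6 + d) / m)) (b₃ m (5 + d)) 7 ⟩
    suc ((6 + d) / m) + (b₃ m (5 + d) + 7)   ≤⟨ +-mono-≤ (m<n*o⇒m/o<n {n = 3} 6+d<3m) (from-five d 5+d<3m) ⟩
    3 + 3 * (5 + d)                          ≡⟨ *-suc 3 (5 + d) ⟨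
    3 * (6 + d)                              ∎
    where
    open ≤-Reasoning
    5+d<3m : 5 + d < 3 * m
    5+d<3m = <-trans (n<1+n (5 + d)) 6+d<3m

-- The difference of the two sides is (a - 2) * (c - 2).
3*suc[a+c]≤suc[a]*suc[c]+6 : ∀ {a c} → 2 ≤ a → 2 ≤ c → 3 * suc (a + c) ≤ suc a * suc c + 6
3*suc[a+c]≤suc[a]*suc[c]+6 {suc (suc x)} {suc (suc y)} (s≤s (s≤s _)) (s≤s (s≤s _)) =
  subst (3 * suc (2 + x + (2 + y)) ≤_) identity (m≤m+n _ (x * y))
  where
  open +-*-Solver
  identity : 3 * suc (2 + x + (2 + y)) + x * y ≡ suc (2 + x) * suc (2 + y) + 6
  identity = solve 2 (λ x y → con 3 :* (con 3 :+ x :+ (con 2 :+ y)) :+ x :* y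
                            := (con 3 :+ x) :* (con 3 :+ y) :+ con 6) refl x y

b₃<suc*suc : ∀ m .{{_ : NonZero m}} → 4 ≤ m → ∀ {a c} → 2 ≤ a → 2 ≤ c → a + c ≤ 2 * m →
             b₃ m (suc (a + c)) < suc a * suc c
b₃<suc*suc m 4≤m {a} {c} 2≤a 2≤c a+c≤2m = +-cancelʳ-≤ 6 _ _ (begin
  suc (b₃ m (suc (a + c))) + 6   ≡⟨ +-suc (b₃ m (suc (a + c))) 6 ⟨
  b₃ m (suc (a + c)) + 7         ≤⟨ b₃+7≤3* m 4≤m (s≤s (+-mono-≤ 2≤a 2≤c)) 1+a+c<3m ⟩
  3 * suc (a + c)                ≤⟨ 3*suc[a+c]≤suc[a]*suc[c]+6 2≤a 2≤c ⟩
  suc a * suc c + 6              ∎)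
  where
  open ≤-Reasoning
  1+a+c<3m : suc (a + c) < 3 * m
  1+a+c<3m = ≤-trans (s≤s (s≤s a+c≤2m)) (+-monoˡ-≤ (2 * m) (≤-trans (s≤s (s≤s z≤n)) 4≤m))

lemma4p3 : (m : ℕ) → 4 ≤ m → (w z : ℕ) → 2 * m ≤ w → 2 * m ≤ z →
    w + z ≤ 2 * (m * m) → b m (w + z) < b m w * b m z
lemma4p3 m 4≤m w z 2m≤w 2m≤z w+z≤2m² = begin-strict
  b m (w + z)          ≡⟨ b≡b₃ (≤-trans 2m≤w (m≤m+n w z)) w+z≤2m² ⟩
  b₃ m ((w + z) / m)   ≤⟨ b₃-mono m ([m+n]/d≤suc[m/d+n/d] w z m) ⟩
  b₃ m (suc (a + c))   <⟨ b₃<suc*suc m 4≤m (m*n≤o⇒m≤o/n 2 2m≤w) (m*n≤o⇒m≤o/n 2 2m≤z) a+c≤2m ⟩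
  suc a * suc c        ≤⟨ *-mono-≤ (suc[n/m]≤b 2m≤w (≤-trans (m≤m+n w z) w+z≤2m²))
                                   (suc[n/m]≤b 2m≤z (≤-trans (m≤n+m z w) w+z≤2m²)) ⟩
  b m w * b m z        ∎
  where
  open ≤-Reasoning
  instance
    m≢0 : NonZero m
    m≢0 = >-nonZero (≤-trans (s≤s z≤n) 4≤m)

  a = w / m
  c = z / m

  3≤m : 3 ≤ m
  3≤m = ≤-trans (n≤1+n 3) 4≤m

  b≡b₃ : ∀ {n} → 2 * m ≤ n → n ≤ 2 * (m * m) → b m n ≡ b₃ m (n / m)
  b≡b₃ {n} 2m≤n n≤2m² = b-below-cube m n (≤-trans 3≤m (≤-trans (m≤m+n m (m + 0)) 2m≤n))
                                         (≤-<-trans n≤2m² (2*[m*m]<m^3 m 3≤m))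

  suc[n/m]≤b : ∀ {n} → 2 * m ≤ n → n ≤ 2 * (m * m) → suc (n / m) ≤ b m n
  suc[n/m]≤b {n} 2m≤n n≤2m² = subst (suc (n / m) ≤_) (sym (b≡b₃ 2m≤n n≤2m²)) (suc≤b₃ m (n / m))

  a+c≤2m : a + c ≤ 2 * m
  a+c≤2m = m+n≤o*d⇒m/d+n/d≤o w z (2 * m) (subst (w + z ≤_) (sym (*-assoc 2 m m)) w+z≤2m²)
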